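{- Every finite metric space $(X,d)$ with $|X|\ge2$ and pairwise distinct distances has a farthest neighbour representation in the Euclidean plane $\mathbb{E}_2$, i.e. there is an injective map $f:X\to\mathbb{R}^2$ such that for every $x\in X$ the point $f(\mathrm{fn}(x))$ is the unique point of $f[X]\setminus\{f(x)\}$ at maximal Euclidean distance from $f(x)$.
   Context: Pairwise distinct distances means $d(x,y)=d(x',y')>0$ implies $\{x,y\}=\{x',y'\}$. For $x\in X$, $\mathrm{fn}(x)$ (the farthest neighbour of $x$) is the unique $y\in X\setminus\{x\}$ maximizing $d(x,y)$. -}

module Defs where

open import Level using (Level; suc; _⊔_)
open import Data.Nat using (ℕ; _≥_)
open import Data.Fin using (Fin)
open import Data.Product using (Σ; ∃; _×_; _,_)
open import Data.Sum using (_⊎_)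
open import Relation.Nullary using (¬_)
open import Relation.Binary.PropositionalEquality using (_≡_; _≢_)
open import Relation.Binary.Definitions using (Decidable)

-- An abstract model of the real numbers: a complete ordered field
-- (axioms of a Dedekind-complete ordered field, which characterise ℝ up to
-- isomorphism), with decidable order (classically true of ℝ).
record RealNumbers : Set₁ where
  infixl 6 _+_ _-_
  infixl 7 _*_
  infix  4 _<_ _≤_
  field
    ℝ    : Set
    0ℝ 1ℝ : ℝ
    _+_ _*_ : ℝ → ℝ → ℝ
    -_   : ℝ → ℝ
    _⁻¹  : (x : ℝ) → x ≢ 0ℝ → ℝ
    _<_  : ℝ → ℝ → Set
    +-assoc : ∀ x y z → (x + y) + z ≡ x + (y + z)
    +-comm  : ∀ x y → x + y ≡ y + x
    +-idʳ   : ∀ x → x + 0ℝ ≡ x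
    +-invʳ  : ∀ x → x + (- x) ≡ 0ℝ
    *-assoc : ∀ x y z → (x * y) * z ≡ x * (y * z)
    *-comm  : ∀ x y → x * y ≡ y * x
    *-idʳ   : ∀ x → x * 1ℝ ≡ x
    *-invʳ  : ∀ x (nz : x ≢ 0ℝ) → x * (x ⁻¹) nz ≡ 1ℝ
    distribˡ : ∀ x y z → x * (y + z) ≡ x * y + x * z
    0≢1     : 0ℝ ≢ 1ℝ
    <-irrefl : ∀ x → ¬ (x < x)
    <-trans  : ∀ {x y z} → x < y → y < z → x < z
    <-trichotomous : ∀ x y → (x < y) ⊎ (x ≡ y) ⊎ (y < x)
    _<?_     : Decidable _<_
    +-mono-< : ∀ {x y} z → x < y → x + z < y + z
    *-pos    : ∀ {x y} → 0ℝ < x → 0ℝ < y → 0ℝ < x * y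
    complete : (P : ℝ → Set) → (∃ λ x → P x) →
               (∃ λ b → ∀ x → P x → ¬ (b < x)) →
               ∃ λ s → (∀ x → P x → ¬ (s < x)) ×
                       (∀ b → (∀ x → P x → ¬ (b < x)) → ¬ (b < s))

  _≤_ : ℝ → ℝ → Set
  x ≤ y = ¬ (y < x)

  _-_ : ℝ → ℝ → ℝ
  x - y = x + (- y)

  -- the Euclidean plane ℝ² and the squared Euclidean distance
  -- (comparing squared distances is the same as comparing distances)
  Point : Set
  Point = ℝ × ℝ

  dist² : Point → Point → ℝ
  dist² (a , b) (c , e) = (a - c) * (a - c) + (b - e) * (b - e)

module _ (R : RealNumbers) where
  open RealNumbers R

  record IsMetric {n : ℕ} (d : Fin n → Fin n → ℝ) : Set where
    field
      nonneg   : ∀ x y → 0ℝ ≤ d x y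
      zero-iff : ∀ x y → d x y ≡ 0ℝ → x ≡ y
      self     : ∀ x → d x x ≡ 0ℝ
      sym      : ∀ x y → d x y ≡ d y x
      triangle : ∀ x y z → d x z ≤ d x y + d y z

  DistinctDistances : {n : ℕ} → (Fin n → Fin n → ℝ) → Set
  DistinctDistances {n} d = ∀ (x y x' y' : Fin n) →
    d x y ≡ d x' y' → 0ℝ < d x y →
    (x ≡ x' × y ≡ y') ⊎ (x ≡ y' × y ≡ x')

  IsFarthest : {n : ℕ} → (Fin n → Fin n → ℝ) → Fin n → Fin n → Set
  IsFarthest {n} d x y = y ≢ x × (∀ (z : Fin n) → z ≢ x → z ≢ y → d x z < d x y)

  IsFarthestPoint : {n : ℕ} → (Fin n → Point) → Fin n → Fin n → Set
  IsFarthestPoint {n} f x y = f y ≢ f x ×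
    (∀ (z : Fin n) → f z ≢ f x → f z ≢ f y → dist² (f x) (f z) < dist² (f x) (f y))

  FNRepresentation : {n : ℕ} → (Fin n → Fin n → ℝ) → (Fin n → Point) → Set
  FNRepresentation {n} d f =
    (∀ (x y : Fin n) → f x ≡ f y → x ≡ y) ×
    (∀ (x y : Fin n) → IsFarthest d x y → IsFarthestPoint f x y)

{-# OPTIONS --safe #-}
module Submission where

open import Defs
open import Data.Nat using (ℕ; _≥_)
open import Data.Fin using (Fin)
open import Data.Product using (∃)

open import Algebra.Bundles using (CommutativeRing)
open import Data.Bool using (Bool; true; false; not)
open import Data.Bool.Properties as Boolₚ using (¬-not)
open import Data.Empty using (⊥-elim)
open import Data.Fin as Fin using (toℕ)
import Data.Fin.Properties as Finₚ
open import Data.Integer as ℤ using (ℤ; +_; -[1+_]; +[1+_]; +0; 0ℤ; 1ℤ; +≤+; +<+)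
import Data.Integer.Properties as ℤₚ
open import Data.Integer.Tactic.RingSolver using (solve-∀)
open import Data.List using (allFin)
open import Data.List.Membership.Propositional.Properties using (∈-allFin)
import Data.List.Relation.Unary.All as All
open import Data.Nat as ℕ using (zero; suc; z≤n; s≤s; NonZero)
import Data.Nat.Properties as ℕₚ
open import Data.Nat.DivMod using (_%_; [m+kn]%n≡m%n; m<n⇒m%n≡m)
open import Data.Nat.GeneralisedArithmetic using (iterate)
open import Data.Product using (_×_; _,_; proj₁; proj₂)
open import Data.Sum using (_⊎_; inj₁; inj₂)
open import Function using (_∘_)
open import Relation.Binary using (Rel; Transitive; Irreflexive; Trichotomous; tri<; tri≈; tri>)
open import Relation.Binary.Bundles using (StrictTotalOrder; DecTotalOrder)
open import Relation.Binary.PropositionalEquality as ≡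
  using (_≡_; _≢_; refl; cong; cong₂; subst; subst₂; module ≡-Reasoning)
open import Relation.Nullary using (¬_; Dec; yes; no; contradiction)

-- The farthest-neighbour map fn has no fixed points and no cycles longer than two: along
-- x, fn x, fn (fn x), … the distance d(y, fn y) strictly increases until a two-cycle is
-- reached. So fn is a forest of in-trees hanging off two-cycles, and it suffices to realise
-- every such map by points of ℤ², which sits inside any ordered field.
--
-- Colour the forest properly with two colours and give every x an integer position p x and
-- weight u x ≥ 0 such that, for the cost c(x, y) = (p x − p y)² + 2 (u x + u y), fn x is the
-- unique cheapest point of the other colour. The base-(2n+1) numeral q x recording the path
-- from x to its two-cycle satisfies q x = (2n+1) q (fn x) + s with 2s < 2n+1; with u = n q²
-- and p = q shifted by a large multiple of an index of the component, c(x, ·) is minimised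
-- at the code nearest to q x / (2n+1), namely q (fn x), and other components are far away.
-- Finally put one colour at (h p, p² + u) and the other at (−h p, h² − p² − u). For points
-- of opposite colours the squared distance is h⁴ + (v x + v y)² − h² c(x, y) with
-- v = p² + u, so the cheapest becomes the farthest, while for large h points of equal
-- colour are closer to each other than any two points of opposite colours.

-- Arithmetic

quotRem-unique : ∀ {C q q′ t t′} .{{_ : NonZero C}} → q ℕ.< C → q′ ℕ.< C →
                 q ℕ.+ t ℕ.* C ≡ q′ ℕ.+ t′ ℕ.* C → q ≡ q′ × t ≡ t′
quotRem-unique {C} {q} {q′} {t} {t′} q<C q′<C eq =
  q≡q′ , ℕₚ.*-cancelʳ-≡ t t′ C (ℕₚ.+-cancelˡ-≡ q _ _
                                  (≡.trans eq (cong (ℕ._+ t′ ℕ.* C) (≡.sym q≡q′))))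
  where
  open ≡-Reasoning
  q≡q′ : q ≡ q′
  q≡q′ = begin
    q                     ≡⟨ m<n⇒m%n≡m q<C ⟨
    q % C                 ≡⟨ [m+kn]%n≡m%n q t C ⟨
    (q ℕ.+ t ℕ.* C) % C   ≡⟨ cong (_% C) eq ⟩
    (q′ ℕ.+ t′ ℕ.* C) % C ≡⟨ [m+kn]%n≡m%n q′ t′ C ⟩
    q′ % C                ≡⟨ m<n⇒m%n≡m q′<C ⟩
    q′                    ∎

bounded : ∀ {n} (f : Fin n → ℕ) → ∃ λ K → ∀ i → f i ℕ.≤ K
bounded {zero}  f = 0 , λ ()
bounded {suc n} f with bounded (f ∘ Fin.suc)
... | K , f≤K = f Fin.zero ℕ.⊔ K , λ
  { Fin.zero    → ℕₚ.m≤m⊔n _ K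
  ; (Fin.suc i) → ℕₚ.≤-trans (f≤K i) (ℕₚ.m≤n⊔m _ K) }

<ᵇ-flip : ∀ m n → m ≢ n → (n ℕ.<ᵇ m) ≡ not (m ℕ.<ᵇ n)
<ᵇ-flip zero    zero    m≢n = ⊥-elim (m≢n refl)
<ᵇ-flip zero    (suc n) _   = refl
<ᵇ-flip (suc m) zero    _   = refl
<ᵇ-flip (suc m) (suc n) m≢n = <ᵇ-flip m n (m≢n ∘ cong suc)


module Integers where
  open import Data.Integer using (_+_; _*_; _-_; -_; _≤_; _<_)

  0≤+ : ∀ n → 0ℤ ≤ + n
  0≤+ n = +≤+ z≤n

  0≤i*i : ∀ i → 0ℤ ≤ i * i
  0≤i*i (+ m)    = subst (0ℤ ≤_) (ℤₚ.pos-* m m) (+≤+ z≤n)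
  0≤i*i -[1+ m ] = +≤+ z≤n

  +-nonNeg : ∀ {i j} → 0ℤ ≤ i → 0ℤ ≤ j → 0ℤ ≤ i + j
  +-nonNeg = ℤₚ.+-mono-≤

  *-nonNeg : ∀ {i j} → 0ℤ ≤ i → 0ℤ ≤ j → 0ℤ ≤ i * j
  *-nonNeg {+ m} {+ k} _ _ = subst (0ℤ ≤_) (ℤₚ.pos-* m k) (+≤+ z≤n)

  0<1+i : ∀ {i} → 0ℤ ≤ i → 0ℤ < 1ℤ + i
  0<1+i (+≤+ _) = +<+ (s≤s z≤n)

  *-monoˡ-≤-nonNeg′ : ∀ {i j k} → 0ℤ ≤ i → j ≤ k → i * j ≤ i * k
  *-monoˡ-≤-nonNeg′ {i} 0≤i = ℤₚ.*-monoˡ-≤-nonNeg i {{ℤ.nonNegative 0≤i}}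

  i*i≤j*j : ∀ {i j} → 0ℤ ≤ i → i ≤ j → i * i ≤ j * j
  i*i≤j*j {i} 0≤i i≤j = ℤₚ.≤-trans (ℤₚ.*-monoʳ-≤-nonNeg i {{ℤ.nonNegative 0≤i}} i≤j)
                                  (*-monoˡ-≤-nonNeg′ (ℤₚ.≤-trans 0≤i i≤j) i≤j)

  i≤i+j : ∀ {i j} → 0ℤ ≤ j → i ≤ i + j
  i≤i+j {i} {j} 0≤j = ℤₚ.i≤i+j i j {{ℤ.nonNegative 0≤j}}

  [i-j]*[i-j]≤i*i+j*j : ∀ {i j} → 0ℤ ≤ i → 0ℤ ≤ j → (i - j) * (i - j) ≤ i * i + j * j
  [i-j]*[i-j]≤i*i+j*j {i} {j} 0≤i 0≤j = subst ((i - j) * (i - j) ≤_) (expand i j)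
    (i≤i+j (*-nonNeg (0≤+ 2) (*-nonNeg 0≤i 0≤j)))
    where
    expand : ∀ i j → (i - j) * (i - j) + + 2 * (i * j) ≡ i * i + j * j
    expand = solve-∀

  i≤i*i : ∀ {i} → 0ℤ < i → i ≤ i * i
  i≤i*i {+0}       (+<+ ())
  i≤i*i {+[1+ k ]} _ = +≤+ (ℕₚ.m≤m*n (suc k) (suc k))

  i<i+j : ∀ {i j} → 0ℤ < j → i < i + j
  i<i+j {i} {j} 0<j = subst (_< i + j) (ℤₚ.+-identityʳ i) (ℤₚ.+-monoʳ-< i 0<j)

  i<j⇒0<j-i : ∀ {i j} → i < j → 0ℤ < j - i
  i<j⇒0<j-i {i} {j} i<j = subst (_< j - i) (ℤₚ.+-inverseʳ i) (ℤₚ.+-monoˡ-< (- i) i<j)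

  i≤+∣i∣ : ∀ i → i ≤ + ℤ.∣ i ∣
  i≤+∣i∣ (+ m)    = ℤₚ.≤-refl
  i≤+∣i∣ -[1+ m ] = ℤ.-≤+

  sqDistℤ : ℤ × ℤ → ℤ × ℤ → ℤ
  sqDistℤ (a , b) (c , e) = (a - c) * (a - c) + (b - e) * (b - e)

  cost : ℤ → ℤ → ℤ → ℤ → ℤ
  cost p u p′ u′ = (p - p′) * (p - p′) + + 2 * (u + u′)

  -- Moving from a to a + e adds e ((1 + 2b) e − 2s) to the cost, positive as 2s < 1 + 2b.
  cost-minimal-at-quotient : ∀ {b s e} a → 0ℤ ≤ s → s ≤ b → e ≢ 0ℤ →
    let X = s + a * (1ℤ + + 2 * b) in
    cost X (b * (X * X)) a (b * (a * a)) < cost X (b * (X * X)) (a + e) (b * ((a + e) * (a + e)))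
  cost-minimal-at-quotient {b} {s} {e} a 0≤s s≤b e≢0 =
    subst (_ <_) (≡.sym (shift-by b s a e)) (i<i+j (margin-pos e e≢0))
    where
    shift-by : ∀ b s a e → let X = s + a * (1ℤ + + 2 * b) in
      (X - (a + e)) * (X - (a + e)) + + 2 * (b * (X * X) + b * ((a + e) * (a + e))) ≡
      (X - a) * (X - a) + + 2 * (b * (X * X) + b * (a * a)) + e * ((1ℤ + + 2 * b) * e - + 2 * s)
    shift-by = solve-∀
    0≤b : 0ℤ ≤ b
    0≤b = ℤₚ.≤-trans 0≤s s≤b
    0≤1+2b : 0ℤ ≤ 1ℤ + + 2 * b
    0≤1+2b = +-nonNeg (0≤+ 1) (*-nonNeg (0≤+ 2) 0≤b)
    positive-margin : ∀ b s k → (1ℤ + k) * ((1ℤ + + 2 * b) * (1ℤ + k) - + 2 * s) ≡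
      1ℤ + (k + (+ 2 * (b - s) + (1ℤ + + 2 * b) * k) + k * (+ 2 * (b - s) + (1ℤ + + 2 * b) * k))
    positive-margin = solve-∀
    negative-margin : ∀ b s k → (- (1ℤ + k)) * ((1ℤ + + 2 * b) * (- (1ℤ + k)) - + 2 * s) ≡
      1ℤ + (k + (+ 2 * b + (1ℤ + + 2 * b) * k + + 2 * s) + k * (+ 2 * b + (1ℤ + + 2 * b) * k + + 2 * s))
    negative-margin = solve-∀
    margin-pos : ∀ e → e ≢ 0ℤ → 0ℤ < e * ((1ℤ + + 2 * b) * e - + 2 * s)
    margin-pos +0 e≢0 = contradiction refl e≢0
    margin-pos +[1+ k ] _ = subst (0ℤ <_) (≡.sym (positive-margin b s (+ k)))
      (0<1+i (+-nonNeg (+-nonNeg (0≤+ k) 0≤T) (*-nonNeg (0≤+ k) 0≤T)))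
      where
      0≤T : 0ℤ ≤ + 2 * (b - s) + (1ℤ + + 2 * b) * + k
      0≤T = +-nonNeg (*-nonNeg (0≤+ 2) (ℤₚ.i≤j⇒0≤j-i s≤b)) (*-nonNeg 0≤1+2b (0≤+ k))
    margin-pos -[1+ k ] _ = subst (0ℤ <_) (≡.sym (negative-margin b s (+ k)))
      (0<1+i (+-nonNeg (+-nonNeg (0≤+ k) 0≤T) (*-nonNeg (0≤+ k) 0≤T)))
      where
      0≤T : 0ℤ ≤ + 2 * b + (1ℤ + + 2 * b) * + k + + 2 * s
      0≤T = +-nonNeg (+-nonNeg (*-nonNeg (0≤+ 2) 0≤b) (*-nonNeg 0≤1+2b (0≤+ k)))
                     (*-nonNeg (0≤+ 2) 0≤s)

  offset-separates : ∀ {m l r r′ s s′} → 0ℤ ≤ m → 0ℤ ≤ l → 0ℤ ≤ r′ → r ≤ m → s < s′ →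
                     let c = 1ℤ + (m + l) in l < (r′ + s′ * c) - (r + s * c)
  offset-separates {m} {l} {r} {r′} {s} {s′} 0≤m 0≤l 0≤r′ r≤m s<s′ = begin-strict
    l                                    <⟨ ℤₚ.suc[i]≤j⇒i<j ℤₚ.≤-refl ⟩
    1ℤ + l                               ≡⟨ unit m l ⟩
    (0ℤ - m) + 1ℤ * c                    ≤⟨ ℤₚ.+-mono-≤ (ℤₚ.+-mono-≤ 0≤r′ (ℤₚ.neg-mono-≤ r≤m))
                                              (ℤₚ.*-monoʳ-≤-nonNeg c {{ℤ.nonNegative 0≤c}}
                                                (ℤₚ.i<j⇒suc[i]≤j (i<j⇒0<j-i s<s′))) ⟩
    (r′ - r) + (s′ - s) * c              ≡⟨ regroup r r′ s s′ c ⟩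
    (r′ + s′ * c) - (r + s * c)          ∎
    where
    open ℤₚ.≤-Reasoning
    c = 1ℤ + (m + l)
    0≤c : 0ℤ ≤ c
    0≤c = +-nonNeg (0≤+ 1) (+-nonNeg 0≤m 0≤l)
    unit : ∀ m l → 1ℤ + l ≡ (0ℤ - m) + 1ℤ * (1ℤ + (m + l))
    unit = solve-∀
    regroup : ∀ r r′ s s′ c → (r′ - r) + (s′ - s) * c ≡ (r′ + s′ * c) - (r + s * c)
    regroup = solve-∀

open Integers

-- The integers inside an ordered field

module OrderedField (R : RealNumbers) where
  open RealNumbers R

  +-*-commutativeRing : CommutativeRing _ _
  +-*-commutativeRing = record
    { Carrier = ℝ ; _≈_ = _≡_ ; _+_ = _+_ ; _*_ = _*_ ; -_ = -_ ; 0# = 0ℝ ; 1# = 1ℝ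
    ; isCommutativeRing = record
      { isRing = record
        { +-isAbelianGroup = record
          { isGroup = record
            { isMonoid = record
              { isSemigroup = record
                { isMagma = record { isEquivalence = ≡.isEquivalence ; ∙-cong = cong₂ _+_ }
                ; assoc   = +-assoc }
              ; identity = (λ x → ≡.trans (+-comm 0ℝ x) (+-idʳ x)) , +-idʳ }
            ; inverse = (λ x → ≡.trans (+-comm (- x) x) (+-invʳ x)) , +-invʳ
            ; ⁻¹-cong = cong (λ v → - v) }
          ; comm = +-comm }
        ; *-cong     = cong₂ _*_
        ; *-assoc    = *-assoc
        ; *-identity = (λ x → ≡.trans (*-comm 1ℝ x) (*-idʳ x)) , *-idʳ
        ; distrib    = distribˡ , λ x y z → ≡.trans (*-comm (y + z) x)
                         (≡.trans (distribˡ x y z) (cong₂ _+_ (*-comm x y) (*-comm x z))) }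
      ; *-comm = *-comm } }

  <-strictTotalOrder : StrictTotalOrder _ _ _
  <-strictTotalOrder = record
    { isStrictTotalOrder = record
      { isStrictPartialOrder = record
        { isEquivalence = ≡.isEquivalence
        ; irrefl        = λ { refl → <-irrefl _ }
        ; trans         = <-trans
        ; <-resp-≈      = (λ { refl p → p }) , (λ { refl p → p })
        }
      ; compare = compare
      }
    }
    where
    compare : Trichotomous _≡_ _<_
    compare x y with <-trichotomous x y
    ... | inj₁ x<y         = tri< x<y (λ { refl → <-irrefl x x<y }) (λ y<x → <-irrefl x (<-trans x<y y<x))
    ... | inj₂ (inj₁ refl) = tri≈ (<-irrefl x) refl (<-irrefl x)
    ... | inj₂ (inj₂ y<x)  = tri> (λ x<y → <-irrefl x (<-trans x<y y<x)) (λ { refl → <-irrefl x y<x }) y<x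

  open CommutativeRing +-*-commutativeRing using (ring; semiring; +-identityˡ; +-commutativeSemigroup)
  open import Algebra.Properties.Ring ring using (-0#≈0#; -‿involutive; -‿+-comm; -‿distribˡ-*; -‿distribʳ-*)
  open import Algebra.Properties.Semiring.Mult semiring using (×-homo-+; ×1-homo-*) renaming (_×_ to _×ℝ_)
  open import Algebra.Properties.CommutativeSemigroup +-commutativeSemigroup using (interchange)

  ι : ℤ → ℝ
  ι (+ m)    = m ×ℝ 1ℝ
  ι -[1+ m ] = - (suc m ×ℝ 1ℝ)

  ι-⊖ : ∀ m k → ι (m ℤ.⊖ k) ≡ m ×ℝ 1ℝ - k ×ℝ 1ℝ
  ι-⊖ m       zero    = ≡.sym (≡.trans (cong (λ v → m ×ℝ 1ℝ + v) -0#≈0#) (+-idʳ (m ×ℝ 1ℝ)))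
  ι-⊖ zero    (suc k) = ≡.sym (+-identityˡ _)
  ι-⊖ (suc m) (suc k) = begin
    ι (suc m ℤ.⊖ suc k)                       ≡⟨ cong ι (ℤₚ.[1+m]⊖[1+n]≡m⊖n m k) ⟩
    ι (m ℤ.⊖ k)                               ≡⟨ ι-⊖ m k ⟩
    m ×ℝ 1ℝ - k ×ℝ 1ℝ                           ≡⟨ +-identityˡ _ ⟨
    0ℝ + (m ×ℝ 1ℝ - k ×ℝ 1ℝ)                    ≡⟨ cong (_+ (m ×ℝ 1ℝ - k ×ℝ 1ℝ)) (+-invʳ 1ℝ) ⟨
    (1ℝ - 1ℝ) + (m ×ℝ 1ℝ - k ×ℝ 1ℝ)              ≡⟨ interchange 1ℝ (- 1ℝ) (m ×ℝ 1ℝ) (- (k ×ℝ 1ℝ)) ⟩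
    (1ℝ + m ×ℝ 1ℝ) + (- 1ℝ + - (k ×ℝ 1ℝ))        ≡⟨ cong (λ v → (1ℝ + m ×ℝ 1ℝ) + v) (-‿+-comm 1ℝ (k ×ℝ 1ℝ)) ⟩
    suc m ×ℝ 1ℝ - suc k ×ℝ 1ℝ                   ∎
    where open ≡-Reasoning

  ι-+ : ∀ i j → ι (i ℤ.+ j) ≡ ι i + ι j
  ι-+ (+ m)    (+ k)    = ×-homo-+ 1ℝ m k
  ι-+ (+ m)    -[1+ k ] = ι-⊖ m (suc k)
  ι-+ -[1+ m ] (+ k)    = ≡.trans (ι-⊖ k (suc m)) (+-comm _ _)
  ι-+ -[1+ m ] -[1+ k ] = begin
    - (suc (suc (m ℕ.+ k)) ×ℝ 1ℝ)        ≡⟨ cong (λ j → - (suc j ×ℝ 1ℝ)) (ℕₚ.+-suc m k) ⟨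
    - ((suc m ℕ.+ suc k) ×ℝ 1ℝ)          ≡⟨ cong (λ v → - v) (×-homo-+ 1ℝ (suc m) (suc k)) ⟩
    - (suc m ×ℝ 1ℝ + suc k ×ℝ 1ℝ)         ≡⟨ -‿+-comm _ _ ⟨
    - (suc m ×ℝ 1ℝ) + - (suc k ×ℝ 1ℝ)     ∎
    where open ≡-Reasoning

  ι-neg : ∀ i → ι (ℤ.- i) ≡ - ι i
  ι-neg +0       = ≡.sym -0#≈0#
  ι-neg +[1+ m ] = refl
  ι-neg -[1+ m ] = ≡.sym (-‿involutive _)

  ι-- : ∀ i j → ι (i ℤ.- j) ≡ ι i - ι j
  ι-- i j = ≡.trans (ι-+ i (ℤ.- j)) (cong (λ v → ι i + v) (ι-neg j))

  ι-*-+ : ∀ m j → ι (+ m ℤ.* j) ≡ ι (+ m) * ι j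
  ι-*-+ m (+ k)    = ≡.trans (cong ι (≡.sym (ℤₚ.pos-* m k))) (×1-homo-* m k)
  ι-*-+ m -[1+ k ] = begin
    ι (+ m ℤ.* -[1+ k ])          ≡⟨ cong ι (ℤₚ.neg-distribʳ-* (+ m) (+ suc k)) ⟨
    ι (ℤ.- (+ m ℤ.* + suc k))     ≡⟨ ι-neg (+ m ℤ.* + suc k) ⟩
    - ι (+ m ℤ.* + suc k)         ≡⟨ cong (λ v → - v) (ι-*-+ m (+ suc k)) ⟩
    - (ι (+ m) * ι (+ suc k))     ≡⟨ -‿distribʳ-* _ _ ⟩
    ι (+ m) * ι -[1+ k ]          ∎
    where open ≡-Reasoning

  ι-* : ∀ i j → ι (i ℤ.* j) ≡ ι i * ι j
  ι-* (+ m)    j = ι-*-+ m j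
  ι-* -[1+ m ] j = begin
    ι (-[1+ m ] ℤ.* j)            ≡⟨ cong ι (ℤₚ.neg-distribˡ-* (+ suc m) j) ⟨
    ι (ℤ.- (+ suc m ℤ.* j))       ≡⟨ ι-neg (+ suc m ℤ.* j) ⟩
    - ι (+ suc m ℤ.* j)           ≡⟨ cong (λ v → - v) (ι-*-+ (suc m) j) ⟩
    - (ι (+ suc m) * ι j)         ≡⟨ -‿distribˡ-* _ _ ⟩
    ι -[1+ m ] * ι j              ∎
    where open ≡-Reasoning

  0<1 : 0ℝ < 1ℝ
  0<1 with <-trichotomous 0ℝ 1ℝ
  ... | inj₁ 0<1         = 0<1
  ... | inj₂ (inj₁ 0≡1)  = ⊥-elim (0≢1 0≡1)
  ... | inj₂ (inj₂ 1<0)  = ⊥-elim (<-irrefl 0ℝ (<-trans (subst (0ℝ <_) -1*-1≡1 (*-pos 0<-1 0<-1)) 1<0))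
    where
    0<-1 : 0ℝ < - 1ℝ
    0<-1 = subst₂ _<_ (+-invʳ 1ℝ) (+-identityˡ (- 1ℝ)) (+-mono-< (- 1ℝ) 1<0)
    -1*-1≡1 : - 1ℝ * - 1ℝ ≡ 1ℝ
    -1*-1≡1 = begin
      - 1ℝ * - 1ℝ     ≡⟨ -‿distribˡ-* 1ℝ (- 1ℝ) ⟨
      - (1ℝ * - 1ℝ)   ≡⟨ cong (λ v → - v) (-‿distribʳ-* 1ℝ 1ℝ) ⟨
      - - (1ℝ * 1ℝ)   ≡⟨ -‿involutive (1ℝ * 1ℝ) ⟩
      1ℝ * 1ℝ         ≡⟨ *-idʳ 1ℝ ⟩
      1ℝ              ∎
      where open ≡-Reasoning

  +-pos : ∀ {x y} → 0ℝ < x → 0ℝ < y → 0ℝ < x + y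
  +-pos {x} {y} 0<x 0<y = <-trans (subst (0ℝ <_) (≡.sym (+-identityˡ y)) 0<y) (+-mono-< y 0<x)

  ι-pos : ∀ {i} → 0ℤ ℤ.< i → 0ℝ < ι i
  ι-pos {+0}          (+<+ ())
  ι-pos {+[1+ zero ]}  _ = subst (0ℝ <_) (≡.sym (+-idʳ 1ℝ)) 0<1
  ι-pos {+[1+ suc m ]} _ = +-pos 0<1 (ι-pos {+[1+ m ]} (+<+ (s≤s z≤n)))

  ι-mono-< : ∀ {i j} → i ℤ.< j → ι i < ι j
  ι-mono-< {i} {j} i<j =
    subst₂ _<_ (+-identityˡ (ι i)) ι-split (+-mono-< (ι i) (ι-pos (i<j⇒0<j-i i<j)))
    where
    [j-i]+i≡j : ∀ i j → (j ℤ.- i) ℤ.+ i ≡ j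
    [j-i]+i≡j = solve-∀
    ι-split : ι (j ℤ.- i) + ι i ≡ ι j
    ι-split = ≡.trans (≡.sym (ι-+ (j ℤ.- i) i)) (cong ι ([j-i]+i≡j i j))

  ι-injective : ∀ {i j} → ι i ≡ ι j → i ≡ j
  ι-injective {i} {j} eq with ℤₚ.<-cmp i j
  ... | tri< i<j _ _ = ⊥-elim (<-irrefl (ι j) (subst (_< ι j) eq (ι-mono-< i<j)))
  ... | tri≈ _ i≡j _ = i≡j
  ... | tri> _ _ j<i = ⊥-elim (<-irrefl (ι i) (subst (_< ι i) (≡.sym eq) (ι-mono-< j<i)))

  ι² : ℤ × ℤ → Point
  ι² (a , b) = ι a , ι b

  ι²-injective : ∀ {p p′} → ι² p ≡ ι² p′ → p ≡ p′
  ι²-injective {a , b} {a′ , b′} eq = cong₂ _,_ (ι-injective (cong proj₁ eq)) (ι-injective (cong proj₂ eq))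

  dist²-ι² : ∀ p p′ → dist² (ι² p) (ι² p′) ≡ ι (sqDistℤ p p′)
  dist²-ι² (a , b) (a′ , b′) = ≡.sym (begin
    ι (e ℤ.* e ℤ.+ f ℤ.* f)            ≡⟨ ι-+ (e ℤ.* e) (f ℤ.* f) ⟩
    ι (e ℤ.* e) + ι (f ℤ.* f)          ≡⟨ cong₂ _+_ (ι-* e e) (ι-* f f) ⟩
    ι e * ι e + ι f * ι f              ≡⟨ cong₂ _+_ (cong₂ _*_ (ι-- a a′) (ι-- a a′)) (cong₂ _*_ (ι-- b b′) (ι-- b b′)) ⟩
    dist² (ι² (a , b)) (ι² (a′ , b′))  ∎)
    where
    open ≡-Reasoning
    e f : ℤ
    e = a ℤ.- a′
    f = b ℤ.- b′

  ι²-isFarthestPoint : ∀ {n} {F : Fin n → ℤ × ℤ} {x y} → F y ≢ F x →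
    (∀ z → F z ≢ F y → sqDistℤ (F x) (F z) ℤ.< sqDistℤ (F x) (F y)) → IsFarthestPoint R (ι² ∘ F) x y
  ι²-isFarthestPoint {F = F} {x} {y} Fy≢Fx far =
    Fy≢Fx ∘ ι²-injective ,
    λ z _ ιFz≢ιFy → subst₂ _<_ (≡.sym (dist²-ι² (F x) (F z))) (≡.sym (dist²-ι² (F x) (F y)))
                              (ι-mono-< (far z (ιFz≢ιFy ∘ cong ι²)))


-- Farthest neighbours in a metric space with distinct distances

module FarthestNeighbour (R : RealNumbers) {n : ℕ} (d : Fin n → Fin n → RealNumbers.ℝ R)
                         (metric : IsMetric R d) (distinct : DistinctDistances R d) where
  open RealNumbers R
  open IsMetric metric using (nonneg; zero-iff; self) renaming (sym to d-sym)
  open import Relation.Binary.Properties.StrictTotalOrder (OrderedField.<-strictTotalOrder R)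
    using (decTotalOrder)
  open import Data.List.Extrema (DecTotalOrder.totalOrder decTotalOrder)
    using (argmax; f[xs]≤f[argmax])

  d-pos : ∀ {x y} → y ≢ x → 0ℝ < d x y
  d-pos {x} {y} y≢x with <-trichotomous 0ℝ (d x y)
  ... | inj₁ 0<d         = 0<d
  ... | inj₂ (inj₁ 0≡d)  = ⊥-elim (y≢x (≡.sym (zero-iff x y (≡.sym 0≡d))))
  ... | inj₂ (inj₂ d<0)  = ⊥-elim (nonneg x y d<0)

  farthest-exists : ∀ x y → y ≢ x → ∃ (IsFarthest R d x)
  farthest-exists x y y≢x = m , m≢x , m-far
    where
    m : Fin n
    m = argmax (d x) x (allFin n)
    d-below : ∀ z → d x z < d x m ⊎ d x z ≡ d x m
    d-below z = All.lookup (f[xs]≤f[argmax] x (allFin n)) (∈-allFin z)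
    m≢x : m ≢ x
    m≢x m≡x with d-below y | ≡.trans (cong (d x) m≡x) (self x)
    ... | inj₁ y<m | dm≡0 = <-irrefl 0ℝ (<-trans (d-pos y≢x) (subst (d x y <_) dm≡0 y<m))
    ... | inj₂ y≡m | dm≡0 = <-irrefl 0ℝ (subst (0ℝ <_) (≡.trans y≡m dm≡0) (d-pos y≢x))
    m-far : ∀ z → z ≢ x → z ≢ m → d x z < d x m
    m-far z z≢x z≢m with d-below z
    ... | inj₁ z<m = z<m
    ... | inj₂ z≡m with distinct x z x m z≡m (d-pos z≢x)
    ...   | inj₁ (_ , z≡m′) = ⊥-elim (z≢m z≡m′)
    ...   | inj₂ (_ , z≡x)  = ⊥-elim (z≢x z≡x)

  farthest-unique : ∀ {x y y′} → IsFarthest R d x y → IsFarthest R d x y′ → y ≡ y′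
  farthest-unique {y = y} {y′} (y≢x , y-far) (y′≢x , y′-far) with y Finₚ.≟ y′
  ... | yes y≡y′ = y≡y′
  ... | no  y≢y′ = ⊥-elim (<-irrefl _ (<-trans (y-far y′ y′≢x (y≢y′ ∘ ≡.sym)) (y′-far y y≢x y≢y′)))

  farthest-grows : ∀ {x y z} → IsFarthest R d x y → IsFarthest R d y z → z ≢ x → d x y < d y z
  farthest-grows {x} {y} {z} (y≢x , _) (_ , z-far) z≢x =
    subst (_< d y z) (d-sym y x) (z-far x (y≢x ∘ ≡.sym) (z≢x ∘ ≡.sym))


-- Maps whose orbits end in two-cycles

iterate-suc : ∀ {a} {A : Set a} (f : A → A) x k → iterate f x (suc k) ≡ f (iterate f x k)
iterate-suc f x zero    = refl
iterate-suc f x (suc k) = iterate-suc f (f x) k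

iterate-+ : ∀ {a} {A : Set a} (f : A → A) x m k → iterate f x (m ℕ.+ k) ≡ iterate f (iterate f x m) k
iterate-+ f x zero    k = refl
iterate-+ f x (suc m) k = iterate-+ f (f x) m k

module TwoCycles {n : ℕ} (g : Fin n → Fin n) where

  OnTwoCycle : Fin n → Set
  OnTwoCycle x = g (g x) ≡ x

  onTwoCycle? : ∀ x → Dec (OnTwoCycle x)
  onTwoCycle? x = g (g x) Finₚ.≟ x

  iterate-onTwoCycle : ∀ {x} k → OnTwoCycle x → OnTwoCycle (iterate g x k)
  iterate-onTwoCycle zero    c = c
  iterate-onTwoCycle (suc k) c = iterate-onTwoCycle k (cong g c)

  iterate-injective : ∀ {x y} k → OnTwoCycle x → OnTwoCycle y → iterate g x k ≡ iterate g y k → x ≡ y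
  iterate-injective zero    _  _  eq = eq
  iterate-injective (suc k) cx cy eq =
    ≡.trans (≡.sym cx) (≡.trans (cong g (iterate-injective k (cong g cx) (cong g cy) eq)) cy)

  module _ {b ℓ} {B : Set b} {_<_ : Rel B ℓ} (<-trans : Transitive _<_) (<-irrefl : Irreflexive _≡_ _<_)
           (φ : Fin n → B) (φ-grows : ∀ x → ¬ OnTwoCycle x → φ x < φ (g x)) where

    reaches-twoCycle : ∀ x → OnTwoCycle (iterate g x n)
    reaches-twoCycle x with onTwoCycle? (iterate g x n)
    ... | yes c = c
    ... | no ¬c with Finₚ.pigeonhole (ℕₚ.n<1+n n) (λ k → iterate g x (toℕ k))
    ...   | i , j , i<j , same = contradiction (increasing i<j (Finₚ.toℕ≤pred[n] j)) (<-irrefl (cong φ same))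
      where
      offCycle : ∀ m → m ℕ.≤ n → ¬ OnTwoCycle (iterate g x m)
      offCycle m m≤n c = ¬c (subst OnTwoCycle
        (≡.trans (≡.sym (iterate-+ g x m (n ℕ.∸ m))) (cong (iterate g x) (ℕₚ.m+[n∸m]≡n m≤n)))
        (iterate-onTwoCycle (n ℕ.∸ m) c))
      step : ∀ m → m ℕ.< n → φ (iterate g x m) < φ (iterate g x (suc m))
      step m m<n = subst (λ y → φ (iterate g x m) < φ y) (≡.sym (iterate-suc g x m))
                         (φ-grows _ (offCycle m (ℕₚ.<⇒≤ m<n)))
      increasing : ∀ {i j} → i ℕ.< j → j ℕ.≤ n → φ (iterate g x i) < φ (iterate g x j)
      increasing {i} {suc j} i<1+j j<n with ℕₚ.m<1+n⇒m<n∨m≡n i<1+j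
      ... | inj₁ i<j  = <-trans (increasing i<j (ℕₚ.<⇒≤ j<n)) (step j j<n)
      ... | inj₂ refl = step i j<n


-- Realising such a map as a farthest-point map in ℤ²

module Forest {n : ℕ} (g : Fin n → Fin n) (g-irrefl : ∀ x → g x ≢ x)
              (reaches : ∀ x → TwoCycles.OnTwoCycle g (iterate g x n)) where
  open TwoCycles g
  open ≡-Reasoning

  root : Fin n → Fin n
  root x = iterate g x n

  root-g : ∀ x → root (g x) ≡ g (root x)
  root-g x = iterate-suc g x n

  colour : Fin n → Bool
  colour x = toℕ (root x) ℕ.<ᵇ toℕ (g (root x))

  colour-g : ∀ x → colour (g x) ≡ not (colour x)
  colour-g x = begin
    toℕ (root (g x)) ℕ.<ᵇ toℕ (g (root (g x)))  ≡⟨ cong (λ r → toℕ r ℕ.<ᵇ toℕ (g r)) (root-g x) ⟩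
    toℕ (g (root x)) ℕ.<ᵇ toℕ (g (g (root x)))  ≡⟨ cong (λ r → toℕ (g (root x)) ℕ.<ᵇ toℕ r) (reaches x) ⟩
    toℕ (g (root x)) ℕ.<ᵇ toℕ (root x)          ≡⟨ <ᵇ-flip _ _ (g-irrefl (root x) ∘ ≡.sym ∘ Finₚ.toℕ-injective) ⟩
    not (colour x)                              ∎

  orient : Bool → Fin n → Fin n
  orient true  r = r
  orient false r = g r

  -- the end of x's two-cycle with the smaller index
  rep : Fin n → Fin n
  rep x = orient (colour x) (root x)

  rep-g : ∀ x → rep (g x) ≡ rep x
  rep-g x = ≡.trans (cong₂ orient (colour-g x) (root-g x)) (orient-not (colour x) (reaches x))
    where
    orient-not : ∀ b {r} → OnTwoCycle r → orient (not b) (g r) ≡ orient b r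
    orient-not true  c = c
    orient-not false _ = refl

  root-determined : ∀ {x y} → colour x ≡ colour y → rep x ≡ rep y → root x ≡ root y
  root-determined {x} {y} cx≡cy rx≡ry = begin
    root x                    ≡⟨ orient-orient (colour x) (reaches x) ⟨
    orient (colour x) (rep x) ≡⟨ cong₂ orient cx≡cy rx≡ry ⟩
    orient (colour y) (rep y) ≡⟨ orient-orient (colour y) (reaches y) ⟩
    root y                    ∎
    where
    orient-orient : ∀ b {r} → OnTwoCycle r → orient b (orient b r) ≡ r
    orient-orient true  _ = refl
    orient-orient false c = c

  digit : Fin n → ℕ
  digit x with onTwoCycle? x
  ... | yes _ = 0
  ... | no  _ = suc (toℕ x)

  base : ℕ
  base = suc (2 ℕ.* n)

  digit≤n : ∀ x → digit x ℕ.≤ n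
  digit≤n x with onTwoCycle? x
  ... | yes _ = z≤n
  ... | no  _ = Finₚ.toℕ<n x

  digit<base : ∀ x → digit x ℕ.< base
  digit<base x = s≤s (ℕₚ.≤-trans (digit≤n x) (ℕₚ.m≤m+n n _))

  digit-onTwoCycle : ∀ {x} → OnTwoCycle x → digit x ≡ 0
  digit-onTwoCycle {x} c with onTwoCycle? x
  ... | yes _ = refl
  ... | no ¬c = contradiction c ¬c

  digit-injective : ∀ {x y} → digit x ≡ digit y → x ≡ y ⊎ (OnTwoCycle x × OnTwoCycle y)
  digit-injective {x} {y} eq with onTwoCycle? x | onTwoCycle? y
  ... | yes cx | yes cy = inj₂ (cx , cy)
  ... | no _   | no _   = inj₁ (Finₚ.toℕ-injective (ℕₚ.suc-injective eq))
  ... | yes _  | no _   = contradiction eq λ ()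
  ... | no _   | yes _  = contradiction eq λ ()

  code : ℕ → Fin n → ℕ
  code zero    x = 0
  code (suc k) x = digit x ℕ.+ code k (g x) ℕ.* base

  code-stable : ∀ k {x} → OnTwoCycle (iterate g x k) → code (suc k) x ≡ code k x
  code-stable zero    {x} c = ≡.trans (ℕₚ.+-identityʳ (digit x)) (digit-onTwoCycle c)
  code-stable (suc k) {x} c = cong (λ m → digit x ℕ.+ m ℕ.* base) (code-stable k c)

  Q : Fin n → ℕ
  Q x = code (suc n) x

  Q-step : ∀ x → Q x ≡ digit x ℕ.+ Q (g x) ℕ.* base
  Q-step x = cong (λ m → digit x ℕ.+ m ℕ.* base) (≡.sym (code-stable n (reaches (g x))))

  Q-injective : ∀ {x y} → Q x ≡ Q y → x ≡ y ⊎ (OnTwoCycle x × OnTwoCycle y)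
  Q-injective {x} {y} eq = digit-injective (proj₁
    (quotRem-unique {t = Q (g x)} {t′ = Q (g y)} (digit<base x) (digit<base y)
                    (≡.trans (≡.sym (Q-step x)) (≡.trans eq (Q-step y)))))

  point-determined : ∀ {x y} → colour x ≡ colour y → rep x ≡ rep y → Q x ≡ Q y → x ≡ y
  point-determined cx≡cy rx≡ry Qx≡Qy with Q-injective Qx≡Qy
  ... | inj₁ x≡y        = x≡y
  ... | inj₂ (cx , cy) = iterate-injective n cx cy (root-determined cx≡cy rx≡ry)


module Nearest {n : ℕ} (g : Fin n → Fin n) (g-irrefl : ∀ x → g x ≢ x)
               (reaches : ∀ x → TwoCycles.OnTwoCycle g (iterate g x n)) where
  open Forest g g-irrefl reaches
  open import Data.Integer using (_+_; _*_; _-_; _≤_; _<_; ∣_∣)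

  b : ℤ
  b = + n

  q : Fin n → ℤ
  q x = + Q x

  q-step : ∀ x → q x ≡ + digit x + q (g x) * (1ℤ + + 2 * b)
  q-step x = begin
    + Q x                               ≡⟨ cong +_ (Q-step x) ⟩
    + (digit x ℕ.+ Q (g x) ℕ.* base)    ≡⟨ ℤₚ.pos-+ (digit x) _ ⟩
    + digit x + + (Q (g x) ℕ.* base)    ≡⟨ cong (λ m → + digit x + m) (ℤₚ.pos-* (Q (g x)) base) ⟩
    + digit x + q (g x) * + base        ≡⟨ cong (λ m → + digit x + q (g x) * (1ℤ + m)) (ℤₚ.pos-* 2 n) ⟩
    + digit x + q (g x) * (1ℤ + + 2 * b) ∎
    where open ≡-Reasoning

  codeCost : Fin n → Fin n → ℤ
  codeCost x y = cost (q x) (b * (q x * q x)) (q y) (b * (q y * q y))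

  M L C : ℕ
  M = proj₁ (bounded Q)
  L = proj₁ (bounded λ x → ∣ codeCost x (g x) ∣)
  C = suc (M ℕ.+ L)

  q≤M : ∀ x → q x ≤ + M
  q≤M x = +≤+ (proj₂ (bounded Q) x)

  codeCost≤L : ∀ x → codeCost x (g x) ≤ + L
  codeCost≤L x = ℤₚ.≤-trans (i≤+∣i∣ _) (+≤+ (proj₂ (bounded λ x → ∣ codeCost x (g x) ∣) x))

  t : Fin n → ℤ
  t x = + toℕ (rep x)

  -- Components are offset by multiples of C > M + L, so that every cost across components
  -- exceeds every cost between partners.
  P U : Fin n → ℤ
  P x = q x + t x * + C
  U x = b * (q x * q x)

  P-nonNeg : ∀ x → 0ℤ ≤ P x
  P-nonNeg x = +-nonNeg (0≤+ (Q x)) (*-nonNeg (0≤+ (toℕ (rep x))) (0≤+ C))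

  U-nonNeg : ∀ x → 0ℤ ≤ U x
  U-nonNeg x = *-nonNeg (0≤+ n) (0≤i*i (q x))

  P-injective : ∀ x y → colour x ≡ colour y → P x ≡ P y → x ≡ y
  P-injective x y cx≡cy Px≡Py
    with quotRem-unique (Q<C x) (Q<C y) (ℤₚ.+-injective (≡.trans (cast x) (≡.trans Px≡Py (≡.sym (cast y)))))
    where
    Q<C : ∀ z → Q z ℕ.< C
    Q<C z = s≤s (ℕₚ.≤-trans (proj₂ (bounded Q) z) (ℕₚ.m≤m+n M L))
    cast : ∀ z → + (Q z ℕ.+ toℕ (rep z) ℕ.* C) ≡ P z
    cast z = ≡.trans (ℤₚ.pos-+ (Q z) _) (cong (λ m → q z + m) (ℤₚ.pos-* (toℕ (rep z)) C))
  ... | Qx≡Qy , rx≡ry = point-determined cx≡cy (Finₚ.toℕ-injective rx≡ry) Qx≡Qy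

  cost-within : ∀ {x y} → t x ≡ t y → cost (P x) (U x) (P y) (U y) ≡ codeCost x y
  cost-within {x} {y} tx≡ty =
    ≡.trans (cong (λ s → cost (P x) (U x) (q y + s * + C) (U y)) (≡.sym tx≡ty))
            (shift (q x) (q y) (t x * + C) (U x) (U y))
    where
    shift : ∀ a a′ k u u′ → (a + k - (a′ + k)) * (a + k - (a′ + k)) + + 2 * (u + u′) ≡
                            (a - a′) * (a - a′) + + 2 * (u + u′)
    shift = solve-∀

  t-g : ∀ x → t x ≡ t (g x)
  t-g x = cong (+_ ∘ toℕ) (≡.sym (rep-g x))

  nearest-within : ∀ {x z} → rep z ≡ rep x → colour z ≢ colour x → z ≢ g x →
                   cost (P x) (U x) (P (g x)) (U (g x)) < cost (P x) (U x) (P z) (U z)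
  nearest-within {x} {z} rz≡rx cz≢cx z≢gx =
    subst₂ _<_ (≡.sym (cost-within (t-g x))) (≡.sym (cost-within (cong (+_ ∘ toℕ) (≡.sym rz≡rx))))
      (subst₂ (λ X w → cost X (b * (X * X)) (q (g x)) (U (g x)) < cost X (b * (X * X)) w (b * (w * w)))
        (≡.sym (q-step x)) (a+[b-a]≡b (q (g x)) (q z))
        (cost-minimal-at-quotient (q (g x)) (0≤+ (digit x)) (+≤+ (digit≤n x)) e≢0))
    where
    a+[b-a]≡b : ∀ a b → a + (b - a) ≡ b
    a+[b-a]≡b = solve-∀
    Qz≢Qgx : Q z ≢ Q (g x)
    Qz≢Qgx = z≢gx ∘ point-determined (≡.trans (¬-not cz≢cx) (≡.sym (colour-g x)))
                                      (≡.trans rz≡rx (≡.sym (rep-g x)))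
    e≢0 : q z - q (g x) ≢ 0ℤ
    e≢0 = Qz≢Qgx ∘ ℤₚ.+-injective ∘ ℤₚ.i-j≡0⇒i≡j (q z) (q (g x))

  nearest-across : ∀ {x z} → rep z ≢ rep x →
                   cost (P x) (U x) (P (g x)) (U (g x)) < cost (P x) (U x) (P z) (U z)
  nearest-across {x} {z} rz≢rx = begin-strict
    cost (P x) (U x) (P (g x)) (U (g x)) ≡⟨ cost-within (t-g x) ⟩
    codeCost x (g x)                     ≤⟨ codeCost≤L x ⟩
    + L                                  <⟨ separated ⟩
    (P x - P z) * (P x - P z)            ≤⟨ i≤i+j (*-nonNeg (0≤+ 2) (+-nonNeg (U-nonNeg x) (U-nonNeg z))) ⟩
    cost (P x) (U x) (P z) (U z)         ∎
    where
    open ℤₚ.≤-Reasoning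
    swap : ∀ a b → (b - a) * (b - a) ≡ (a - b) * (a - b)
    swap = solve-∀
    L<square : ∀ {e} → + L < e → + L < e * e
    L<square L<e = ℤₚ.<-≤-trans L<e (i≤i*i (ℤₚ.≤-<-trans (0≤+ L) L<e))
    separated : + L < (P x - P z) * (P x - P z)
    separated with ℕₚ.<-cmp (toℕ (rep x)) (toℕ (rep z))
    ... | tri< rx<rz _ _ = subst (+ L <_) (swap (P x) (P z))
      (L<square (offset-separates (0≤+ M) (0≤+ L) (0≤+ (Q z)) (q≤M x) (+<+ rx<rz)))
    ... | tri≈ _ rx≡rz _ = contradiction (Finₚ.toℕ-injective (≡.sym rx≡rz)) rz≢rx
    ... | tri> _ _ rz<rx = L<square (offset-separates (0≤+ M) (0≤+ L) (0≤+ (Q x)) (q≤M z) (+<+ rz<rx))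

  nearest : ∀ x z → colour z ≢ colour x → z ≢ g x →
            cost (P x) (U x) (P (g x)) (U (g x)) < cost (P x) (U x) (P z) (U z)
  nearest x z cz≢cx z≢gx with rep z Finₚ.≟ rep x
  ... | yes rz≡rx = nearest-within rz≡rx cz≢cx z≢gx
  ... | no  rz≢rx = nearest-across rz≢rx


module Lifting {n : ℕ} (g : Fin n → Fin n)
               (colour : Fin n → Bool) (colour-g : ∀ x → colour (g x) ≡ not (colour x))
               (P U : Fin n → ℤ) (P-nonNeg : ∀ x → 0ℤ ℤ.≤ P x) (U-nonNeg : ∀ x → 0ℤ ℤ.≤ U x)
               (P-injective : ∀ x y → colour x ≡ colour y → P x ≡ P y → x ≡ y)
               (nearest : ∀ x z → colour z ≢ colour x → z ≢ g x →
                          cost (P x) (U x) (P (g x)) (U (g x)) ℤ.< cost (P x) (U x) (P z) (U z)) where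
  open import Data.Integer using (_+_; _*_; _-_; -_; _≤_; _<_; ∣_∣)
  open ℤₚ.≤-Reasoning

  V : Fin n → ℤ
  V x = P x * P x + U x

  V-nonNeg : ∀ x → 0ℤ ≤ V x
  V-nonNeg x = +-nonNeg (0≤i*i (P x)) (U-nonNeg x)

  K : ℕ
  K = proj₁ (bounded (∣_∣ ∘ V))

  κ : ℤ
  κ = + K

  V≤κ : ∀ x → V x ≤ κ
  V≤κ x = subst (_≤ κ) (ℤₚ.0≤i⇒+∣i∣≡i (V-nonNeg x)) (+≤+ (proj₂ (bounded (∣_∣ ∘ V)) x))

  h : ℤ
  h = 1ℤ + + 3 * κ

  h-pos : 0ℤ < h
  h-pos = 0<1+i (*-nonNeg (0≤+ 3) (0≤+ K))

  hh-nonNeg : 0ℤ ≤ h * h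
  hh-nonNeg = 0≤i*i h

  -- The second colour is the point reflection of the first through (0, h²/2).
  side : Bool → ℤ → ℤ → ℤ × ℤ
  side true  a v = a , v
  side false a v = - a , h * h - v

  lift : Fin n → ℤ × ℤ
  lift x = side (colour x) (h * P x) (V x)

  crossSq : ℤ → ℤ → ℤ
  crossSq X c = h * h * (h * h) + X * X - h * h * c

  sqDist-same : ∀ {x z} → colour z ≡ colour x →
    sqDistℤ (lift x) (lift z) ≡ h * h * ((P x - P z) * (P x - P z)) + (V x - V z) * (V x - V z)
  sqDist-same {x} {z} cz≡cx =
    ≡.trans (cong (λ c → sqDistℤ (lift x) (side c (h * P z) (V z))) cz≡cx) (same (colour x))
    where
    scaled : ∀ h p p′ v v′ → (h * p - h * p′) * (h * p - h * p′) + (v - v′) * (v - v′) ≡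
                             h * h * ((p - p′) * (p - p′)) + (v - v′) * (v - v′)
    scaled = solve-∀
    reflected : ∀ h p p′ v v′ →
      (- (h * p) - - (h * p′)) * (- (h * p) - - (h * p′)) + (h * h - v - (h * h - v′)) * (h * h - v - (h * h - v′)) ≡
      h * h * ((p - p′) * (p - p′)) + (v - v′) * (v - v′)
    reflected = solve-∀
    same : ∀ c → sqDistℤ (side c (h * P x) (V x)) (side c (h * P z) (V z)) ≡
                 h * h * ((P x - P z) * (P x - P z)) + (V x - V z) * (V x - V z)
    same true  = scaled h (P x) (P z) (V x) (V z)
    same false = reflected h (P x) (P z) (V x) (V z)

  sqDist-opposite : ∀ {x z} → colour z ≡ not (colour x) →
    sqDistℤ (lift x) (lift z) ≡ crossSq (V x + V z) (cost (P x) (U x) (P z) (U z))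
  sqDist-opposite {x} {z} cz≡¬cx =
    ≡.trans (cong (λ c → sqDistℤ (lift x) (side c (h * P z) (V z))) cz≡¬cx) (opposite (colour x))
    where
    upper : ∀ h p u p′ u′ → let v = p * p + u in let v′ = p′ * p′ + u′ in
      (h * p - - (h * p′)) * (h * p - - (h * p′)) + (v - (h * h - v′)) * (v - (h * h - v′)) ≡
      h * h * (h * h) + (v + v′) * (v + v′) - h * h * ((p - p′) * (p - p′) + + 2 * (u + u′))
    upper = solve-∀
    lower : ∀ h p u p′ u′ → let v = p * p + u in let v′ = p′ * p′ + u′ in
      (- (h * p) - h * p′) * (- (h * p) - h * p′) + (h * h - v - v′) * (h * h - v - v′) ≡
      h * h * (h * h) + (v + v′) * (v + v′) - h * h * ((p - p′) * (p - p′) + + 2 * (u + u′))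
    lower = solve-∀
    opposite : ∀ c → sqDistℤ (side c (h * P x) (V x)) (side (not c) (h * P z) (V z)) ≡
                     crossSq (V x + V z) (cost (P x) (U x) (P z) (U z))
    opposite true  = upper h (P x) (U x) (P z) (U z)
    opposite false = lower h (P x) (U x) (P z) (U z)

  crossSq-antitone : ∀ X {c c′} → c ≤ c′ → crossSq X c′ ≤ crossSq X c
  crossSq-antitone X c≤c′ =
    ℤₚ.+-monoʳ-≤ (h * h * (h * h) + X * X) (ℤₚ.neg-mono-≤ (*-monoˡ-≤-nonNeg′ hh-nonNeg c≤c′))

  farther-by-cost : ∀ {X Y c c′} → 0ℤ ≤ X → X < h → c < c′ → crossSq X c′ < crossSq Y c
  farther-by-cost {X} {Y} {c} {c′} 0≤X X<h c<c′ = begin-strict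
    crossSq X c′                                       ≤⟨ crossSq-antitone X (ℤₚ.i<j⇒suc[i]≤j c<c′) ⟩
    crossSq X (1ℤ + c)                                 <⟨ i<i+j (ℤₚ.<-≤-trans (i<j⇒0<j-i XX<hh) (i≤i+j (0≤i*i Y))) ⟩
    crossSq X (1ℤ + c) + ((h * h - X * X) + Y * Y)     ≡⟨ trade h X Y c ⟩
    crossSq Y c                                        ∎
    where
    trade : ∀ h X Y c →
      h * h * (h * h) + X * X - h * h * (1ℤ + c) + ((h * h - X * X) + Y * Y) ≡ h * h * (h * h) + Y * Y - h * h * c
    trade = solve-∀
    XX<hh : X * X < h * h
    XX<hh = ℤₚ.≤-<-trans (ℤₚ.*-monoʳ-≤-nonNeg X {{ℤ.nonNegative 0≤X}} (ℤₚ.<⇒≤ X<h))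
                         (ℤₚ.*-monoˡ-<-pos h {{ℤ.positive h-pos}} X<h)

  VV<h : ∀ x z → V x + V z < h
  VV<h x z = ℤₚ.≤-<-trans (ℤₚ.+-mono-≤ (V≤κ x) (V≤κ z))
    (subst (κ + κ <_) (≡.sym (split κ)) (i<i+j (0<1+i (0≤+ K))))
    where
    split : ∀ k → 1ℤ + + 3 * k ≡ k + k + (1ℤ + k)
    split = solve-∀

  sqDist-same-≤ : ∀ {x z} → colour z ≡ colour x →
                  sqDistℤ (lift x) (lift z) ≤ h * h * (κ + κ) + (κ * κ + κ * κ)
  sqDist-same-≤ {x} {z} cz≡cx = begin
    sqDistℤ (lift x) (lift z)                                      ≡⟨ sqDist-same cz≡cx ⟩
    h * h * ((P x - P z) * (P x - P z)) + (V x - V z) * (V x - V z) ≤⟨ ℤₚ.+-mono-≤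
      (*-monoˡ-≤-nonNeg′ hh-nonNeg ([i-j]*[i-j]≤i*i+j*j (P-nonNeg x) (P-nonNeg z)))
      ([i-j]*[i-j]≤i*i+j*j (V-nonNeg x) (V-nonNeg z)) ⟩
    h * h * (P x * P x + P z * P z) + (V x * V x + V z * V z)       ≤⟨ ℤₚ.+-mono-≤
      (*-monoˡ-≤-nonNeg′ hh-nonNeg (ℤₚ.+-mono-≤ (PP≤κ x) (PP≤κ z))) (ℤₚ.+-mono-≤ (VV≤κκ x) (VV≤κκ z)) ⟩
    h * h * (κ + κ) + (κ * κ + κ * κ)                               ∎
    where
    PP≤κ : ∀ y → P y * P y ≤ κ
    PP≤κ y = ℤₚ.≤-trans (i≤i+j (U-nonNeg y)) (V≤κ y)
    VV≤κκ : ∀ y → V y * V y ≤ κ * κ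
    VV≤κκ y = i*i≤j*j (V-nonNeg y) (V≤κ y)

  cost-≤ : ∀ x y → cost (P x) (U x) (P y) (U y) ≤ + 2 * (κ + κ)
  cost-≤ x y = begin
    (P x - P y) * (P x - P y) + + 2 * (U x + U y)                          ≤⟨ ℤₚ.+-monoˡ-≤ (+ 2 * (U x + U y))
                                                                                ([i-j]*[i-j]≤i*i+j*j (P-nonNeg x) (P-nonNeg y)) ⟩
    (P x * P x + P y * P y) + + 2 * (U x + U y)                            ≤⟨ i≤i+j (+-nonNeg (0≤i*i (P x)) (0≤i*i (P y))) ⟩
    (P x * P x + P y * P y) + + 2 * (U x + U y) + (P x * P x + P y * P y)  ≡⟨ regroup (P x) (U x) (P y) (U y) ⟩
    + 2 * (V x + V y)                                                      ≤⟨ *-monoˡ-≤-nonNeg′ (0≤+ 2)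
                                                                                (ℤₚ.+-mono-≤ (V≤κ x) (V≤κ y)) ⟩
    + 2 * (κ + κ)                                                          ∎
    where
    regroup : ∀ p u p′ u′ →
      (p * p + p′ * p′) + + 2 * (u + u′) + (p * p + p′ * p′) ≡ + 2 * (p * p + u + (p′ * p′ + u′))
    regroup = solve-∀

  -- With h = 3κ + 1 the difference is a polynomial in κ ≥ 0 with positive coefficients.
  same-colour-below : h * h * (κ + κ) + (κ * κ + κ * κ) < crossSq 0ℤ (+ 2 * (κ + κ))
  same-colour-below = subst (h * h * (κ + κ) + (κ * κ + κ * κ) <_) (≡.sym (certificate κ))
                            (i<i+j (0<1+i horner-nonNeg))
    where
    certificate : ∀ k → let h = 1ℤ + + 3 * k in
      h * h * (h * h) + 0ℤ * 0ℤ - h * h * (+ 2 * (k + k)) ≡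
      h * h * (k + k) + (k * k + k * k) + (1ℤ + k * (+ 6 + k * (+ 16 + k * (+ 54 + + 81 * k))))
    certificate = solve-∀
    0≤κ : 0ℤ ≤ κ
    0≤κ = 0≤+ K
    horner-nonNeg : 0ℤ ≤ κ * (+ 6 + κ * (+ 16 + κ * (+ 54 + + 81 * κ)))
    horner-nonNeg = *-nonNeg 0≤κ (+-nonNeg (0≤+ 6) (*-nonNeg 0≤κ (+-nonNeg (0≤+ 16)
                      (*-nonNeg 0≤κ (+-nonNeg (0≤+ 54) (*-nonNeg (0≤+ 81) 0≤κ))))))

  lift-farthest : ∀ x z → z ≢ g x → sqDistℤ (lift x) (lift z) < sqDistℤ (lift x) (lift (g x))
  lift-farthest x z z≢gx = subst (sqDistℤ (lift x) (lift z) <_) (≡.sym (sqDist-opposite (colour-g x)))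
                                 (compare (colour z Boolₚ.≟ colour x))
    where
    far : ℤ
    far = crossSq (V x + V (g x)) (cost (P x) (U x) (P (g x)) (U (g x)))
    compare : Dec (colour z ≡ colour x) → sqDistℤ (lift x) (lift z) < far
    compare (no cz≢cx) = subst (_< far) (≡.sym (sqDist-opposite (¬-not cz≢cx)))
      (farther-by-cost {Y = V x + V (g x)} (+-nonNeg (V-nonNeg x) (V-nonNeg z)) (VV<h x z) (nearest x z cz≢cx z≢gx))
    compare (yes cz≡cx) = begin-strict
      sqDistℤ (lift x) (lift z)                 ≤⟨ sqDist-same-≤ cz≡cx ⟩
      h * h * (κ + κ) + (κ * κ + κ * κ)          <⟨ same-colour-below ⟩
      crossSq 0ℤ (+ 2 * (κ + κ))                ≤⟨ ℤₚ.+-monoˡ-≤ (- (h * h * (+ 2 * (κ + κ))))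
                                                      (ℤₚ.+-monoʳ-≤ (h * h * (h * h)) (0≤i*i (V x + V (g x)))) ⟩
      crossSq (V x + V (g x)) (+ 2 * (κ + κ))   ≤⟨ crossSq-antitone (V x + V (g x)) (cost-≤ x (g x)) ⟩
      far                                       ∎

  lift-injective : ∀ x y → lift x ≡ lift y → x ≡ y
  lift-injective x y eq with colour x Boolₚ.≟ colour y
  ... | yes cx≡cy = P-injective x y cx≡cy (ℤₚ.*-cancelˡ-≡ h (P x) (P y) {{ℤ.>-nonZero h-pos}}
                      (first (colour x) (≡.trans eq (cong (λ c → side c (h * P y) (V y)) (≡.sym cx≡cy)))))
    where
    first : ∀ c {a v a′ v′} → side c a v ≡ side c a′ v′ → a ≡ a′
    first true  eq = cong proj₁ eq
    first false eq = ℤₚ.neg-injective (cong proj₁ eq)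
  ... | no cx≢cy = contradiction (opposite (colour x) (≡.trans eq (cong (λ c → side c (h * P y) (V y)) cy≡¬cx)))
                     (ℤₚ.<⇒≢ (ℤₚ.<-≤-trans (VV<h x y) (i≤i*i h-pos)))
    where
    cy≡¬cx : colour y ≡ not (colour x)
    cy≡¬cx = ¬-not (cx≢cy ∘ ≡.sym)
    cancel : ∀ H v → H - v + v ≡ H
    cancel = solve-∀
    cancel′ : ∀ H v → v + (H - v) ≡ H
    cancel′ = solve-∀
    opposite : ∀ c {a v a′ v′} → side c a v ≡ side (not c) a′ v′ → v + v′ ≡ h * h
    opposite true  {v′ = v′} eq = ≡.trans (cong (_+ v′) (cong proj₂ eq)) (cancel (h * h) v′)
    opposite false {v = v}   eq = ≡.trans (cong (λ w → v + w) (≡.sym (cong proj₂ eq))) (cancel′ (h * h) v)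

FarthestRealisation : ∀ {n} → (Fin n → Fin n) → (Fin n → ℤ × ℤ) → Set
FarthestRealisation g F =
  (∀ x y → F x ≡ F y → x ≡ y) × (∀ x z → z ≢ g x → sqDistℤ (F x) (F z) ℤ.< sqDistℤ (F x) (F (g x)))

twoCycleForest-realisable : ∀ {n} (g : Fin n → Fin n) → (∀ x → g x ≢ x) →
                            (∀ x → TwoCycles.OnTwoCycle g (iterate g x n)) → ∃ (FarthestRealisation g)
twoCycleForest-realisable g g-irrefl reaches = lift , lift-injective , lift-farthest
  where
  open Forest g g-irrefl reaches using (colour; colour-g)
  open Nearest g g-irrefl reaches using (P; U; P-nonNeg; U-nonNeg; P-injective; nearest)
  open Lifting g colour colour-g P U P-nonNeg U-nonNeg P-injective nearest
    using (lift; lift-injective; lift-farthest)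


realisation⇒representation : ∀ (R : RealNumbers) {n} {d : Fin n → Fin n → RealNumbers.ℝ R} {g F} →
  (∀ {x y} → IsFarthest R d x y → y ≡ g x) → (∀ x → g x ≢ x) → FarthestRealisation g F →
  FNRepresentation R d (OrderedField.ι² R ∘ F)
realisation⇒representation R {d = d} {g} {F} unique g-irrefl (F-injective , F-far) =
  (λ x y → F-injective x y ∘ ι²-injective) , represents
  where
  open OrderedField R using (ι²; ι²-injective; ι²-isFarthestPoint)
  represents : ∀ x y → IsFarthest R d x y → IsFarthestPoint R (ι² ∘ F) x y
  represents x y y-far with unique y-far
  ... | refl = ι²-isFarthestPoint {F = F} (g-irrefl x ∘ F-injective (g x) x)
                                  (λ z Fz≢Fgx → F-far x z (Fz≢Fgx ∘ cong F))

theorem9 : (R : RealNumbers) → (n : ℕ) → n ≥ 2 →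
    (d : Fin n → Fin n → RealNumbers.ℝ R) →
    IsMetric R d → DistinctDistances R d →
    ∃ λ (f : Fin n → RealNumbers.Point R) → FNRepresentation R d f
theorem9 R (suc (suc m)) (s≤s (s≤s z≤n)) d metric distinct =
  OrderedField.ι² R ∘ proj₁ realisation ,
  realisation⇒representation R {F = proj₁ realisation} (λ {x} y-far → farthest-unique y-far (fn-farthest x))
                               fn-irrefl (proj₂ realisation)
  where
  open RealNumbers R using (<-trans; <-irrefl)
  open FarthestNeighbour R d metric distinct

  fn-spec : ∀ x → ∃ (IsFarthest R d x)
  fn-spec x = farthest-exists x (Fin.punchIn x Fin.zero) (Finₚ.punchInᵢ≢i x Fin.zero)

  fn : Fin (suc (suc m)) → Fin (suc (suc m))
  fn = proj₁ ∘ fn-spec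

  fn-farthest : ∀ x → IsFarthest R d x (fn x)
  fn-farthest = proj₂ ∘ fn-spec

  fn-irrefl : ∀ x → fn x ≢ x
  fn-irrefl = proj₁ ∘ fn-farthest

  realisation : ∃ (FarthestRealisation fn)
  realisation = twoCycleForest-realisable fn fn-irrefl
    (TwoCycles.reaches-twoCycle fn <-trans (λ { {x} refl → <-irrefl x }) (λ x → d x (fn x))
       (λ x off → farthest-grows (fn-farthest x) (fn-farthest (fn x)) off))
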